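{- Let $m\ge1$ and let $T$ be an $(m+1)$-ary tree of size $n$. Then $\mathcal B^{(m)}_T(x)=\sum_{T'} x^{\lambda(T')}$, where the sum runs over the $(m+1)$-ary trees $T'$ of size $n$ with $T'\le T$ in the $m$-Tamari lattice $\mathcal T^{(m)}_n$, and $\lambda(T')$ is the number of nodes on the left branch of $T'$ (equivalently, the number of returns of the $m$-ballot path of $T'$ to the line $y=x/m$). In particular $\mathcal B^{(m)}_T(1)$ is the number of elements $\le T$ in $\mathcal T^{(m)}_n$.
   Context: An $m$-ballot path of size $n$ is a lattice path from $(0,0)$ to $(mn,n)$ with up steps $(0,1)$ (letter $1$) and horizontal steps $(1,0)$ (letter $0$), never going below the line $y=x/m$. A nonempty path is primitive if it touches the line $y=x/m$ only at its two endpoints. A rotation: if the path (as a word) contains a horizontal step $0$ immediately followed by a factor $c$ which, translated to start at the origin, is a primitive $m$-ballot path, exchange the $0$ and $c$. The $m$-Tamari order $\mathcal T^{(m)}_n$ is the reflexive-transitive closure of rotations ($D\le D'$ if $D'$ is obtained from $D$ by rotations). The number of returns of a path is its number of contacts with $y=x/m$ other than the origin. An $(m+1)$-ary tree is empty or a root with an ordered list of $m+1$ subtrees $T_L,T_{R_1},\dots,T_{R_m}$; its size is its number of nodes; its left branch is the sequence of nodes obtained from the root by repeatedly going to the first subtree $T_L$. Trees correspond bijectively to $m$-ballot paths via $D(\emptyset)=\emptyset$, $D(T)=D(T_L)\,1\,D(T_{R_m})\,0\,D(T_{R_{m-1}})\,0\cdots0\,D(T_{R_1})\,0$; the order $\mathcal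 T^{(m)}_n$ is transported to trees through this bijection. Let $\Delta(g)=\frac{xg(x)-g(1)}{x-1}$ and define $\mathcal B^{(m)}_\emptyset=1$ and $\mathcal B^{(m)}_T=x\,\mathcal B^{(m)}_{T_L}\,\Delta\bigl(\mathcal B^{(m)}_{T_{R_1}}\,\Delta(\mathcal B^{(m)}_{T_{R_2}}\,\Delta(\cdots\Delta(\mathcal B^{(m)}_{T_{R_m}})\cdots))\bigr)$. -}

module Defs where

open import Data.Nat using (ℕ; zero; suc; _+_; _*_; _≤_; _<_)
open import Data.List using (List; []; _∷_; _++_; map)
open import Data.Nat.ListAction using (sum)
open import Data.Vec using (Vec; []; _∷_)
open import Data.Product using (_×_)
open import Relation.Binary.PropositionalEquality using (_≡_; _≢_)
open import Relation.Binary.Construct.Closure.ReflexiveTransitive using (Star)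

-- Lattice paths as words: up = letter 1 = step (0,1),
--                         hor = letter 0 = step (1,0).

data Step : Set where
  up hor : Step

Word : Set
Word = List Step

ups : Word → ℕ
ups []          = 0
ups (up  ∷ w)   = suc (ups w)
ups (hor ∷ w)   = ups w

hors : Word → ℕ
hors []          = 0
hors (up  ∷ w)   = hors w
hors (hor ∷ w)   = suc (hors w)

IsBallot : ℕ → Word → Set
IsBallot m w = (hors w ≡ m * ups w)
             × (∀ u v → w ≡ u ++ v → hors u ≤ m * ups u)

IsPrimitive : ℕ → Word → Set
IsPrimitive m w = (w ≢ [])
                × IsBallot m w
                × (∀ u v → w ≡ u ++ v → u ≢ [] → v ≢ [] → hors u < m * ups u)

data Rot (m : ℕ) : Word → Word → Set where
  rot : ∀ u c v → IsPrimitive m c →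
        Rot m (u ++ hor ∷ c ++ v) (u ++ c ++ hor ∷ v)

_≤P[_]_ : Word → ℕ → Word → Set
D ≤P[ m ] D' = Star (Rot m) D D'

data Tree (m : ℕ) : Set where
  leaf : Tree m
  node : Tree m → Vec (Tree m) m → Tree m

mutual
  size : ∀ {m} → Tree m → ℕ
  size leaf         = 0
  size (node l rs)  = suc (size l + sizes rs)

  sizes : ∀ {m k} → Vec (Tree m) k → ℕ
  sizes []        = 0
  sizes (r ∷ rs)  = size r + sizes rs

leftBranch : ∀ {m} → Tree m → ℕ
leftBranch leaf         = 0
leftBranch (node l _)   = suc (leftBranch l)

-- D(T) = D(T_L) 1 D(T_{R_m}) 0 D(T_{R_{m-1}}) 0 ⋯ 0 D(T_{R_1}) 0
mutual
  path : ∀ {m} → Tree m → Word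
  path leaf         = []
  path (node l rs)  = path l ++ up ∷ pathR rs

  pathR : ∀ {m k} → Vec (Tree m) k → Word
  pathR []        = []
  pathR (r ∷ rs)  = pathR rs ++ path r ++ hor ∷ []

_≤T_ : ∀ {m} → Tree m → Tree m → Set
_≤T_ {m} T' T = path T' ≤P[ m ] path T

-- Polynomials in x with ℕ coefficients, as coefficient lists
-- (constant term first).

Poly : Set
Poly = List ℕ

coeff : Poly → ℕ → ℕ
coeff []       _        = 0
coeff (a ∷ p)  zero     = a
coeff (a ∷ p)  (suc k)  = coeff p k

_+P_ : Poly → Poly → Poly
[]      +P q        = q
(a ∷ p) +P []       = a ∷ p
(a ∷ p) +P (b ∷ q)  = (a + b) ∷ (p +P q)

_*P_ : Poly → Poly → Poly
[]      *P q = []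
(a ∷ p) *P q = map (a *_) q +P (0 ∷ (p *P q))

oneP : Poly
oneP = 1 ∷ []

xP : Poly
xP = 0 ∷ 1 ∷ []

-- Δ(g) = (x g(x) − g(1)) / (x − 1).  For g = Σ a_i x^i this is
-- Σ_i a_i (1 + x + ⋯ + x^i), i.e. coefficient j equals Σ_{i ≥ j} a_i.
Δ : Poly → Poly
Δ []       = []
Δ (a ∷ p)  = (a + sum p) ∷ Δ p

-- B_∅ = 1,  B_T = x B_{T_L} Δ(B_{R_1} Δ(B_{R_2} Δ(⋯ Δ(B_{R_m})⋯)))
mutual
  B : ∀ {m} → Tree m → Poly
  B leaf         = oneP
  B (node l rs)  = (xP *P B l) *P nest rs

  nest : ∀ {m k} → Vec (Tree m) k → Poly
  nest []        = oneP
  nest (r ∷ rs)  = Δ (B r *P nest rs)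

-- Cutting an m-ballot path at its returns to the line writes it as a sequence of primitive paths,
-- and a primitive path is  up D(F_m) hor ⋯ D(F_1) hor  for sequences F_i of primitive paths.  Trees are
-- thus the same as forests of primitives, the left branch of a tree being its top-level forest, and a
-- rotation either acts inside a primitive or lets the closing letter of a kid F_i swap with the primitive
-- right after it, which then joins F_i.  This yields an inductive description of the downset of a forest:
-- within a primitive, the primitives c spilled out of the kids F_m, …, F_{i+1} are followed by an element
-- q of the downset of F_i, and c ++ q is cut anywhere into the new kid and the spill passed on.  Along
-- this description the downset is enumerated without repetition; the |c| + |q| + 1 cuts contribute
-- Δ(x^(|c|+|q|)), so the number of top-level primitives has exactly the generating function B.

module Submission where

open import Defs
open import Data.Nat using (ℕ; zero; suc; _+_; _*_; _≤_; _<_; z≤n; s≤s; _≟_)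
open import Data.Nat.Properties
open import Data.Nat.ListAction using (sum)
open import Data.Nat.Tactic.RingSolver using (solve-∀)
open import Data.List using (List; []; _∷_; _++_; [_]; length; map; filter; drop; concatMap)
open import Data.List.Properties
  using ( ++-monoid; ++-assoc; ++-identityʳ; ++-identityʳ-unique; ++-cancelˡ; ++-cancelʳ; ++-conicalˡ; ++-conicalʳ
        ; ∷-injective; ∷-injectiveʳ; length-++; filter-accept; filter-reject)
open import Data.List.Membership.Propositional using (_∈_; find; lose)
open import Data.List.Membership.Propositional.Properties
  using (∈-map⁺; ∈-map⁻; ∈-concatMap⁺; ∈-concatMap⁻; ∈-filter⁺; ∈-filter⁻)
open import Data.List.Relation.Unary.Any using (here; there)
import Data.List.Relation.Unary.All as All
open import Data.List.Relation.Unary.AllPairs using ([]; _∷_)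
open import Data.List.Relation.Unary.Unique.Propositional using (Unique)
open import Data.List.Relation.Unary.Unique.Propositional.Properties using (++⁺; map⁺; filter⁺)
open import Data.Vec using (Vec; []; _∷_)
import Data.Vec as Vec
open import Data.Product using (_×_; _,_; ∃; ∃₂; proj₁; proj₂)
open import Data.Sum using (_⊎_; inj₁; inj₂)
open import Data.Empty using (⊥; ⊥-elim)
open import Function using (_∘_)
open import Function.Bundles using (_⇔_; mk⇔; Equivalence)
open import Level using (0ℓ)
open import Relation.Nullary using (yes; no; contradiction)
open import Relation.Binary.Bundles using (Setoid)
open import Relation.Binary.PropositionalEquality hiding ([_])
import Relation.Binary.Reasoning.Setoid as SetoidReasoning
open import Relation.Binary.Construct.Closure.ReflexiveTransitive using (Star; ε; _◅_; _◅◅_; gmap)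
open import Tactic.MonoidSolver using (solve)

levi : ∀ {A : Set} (a b c d : List A) → a ++ b ≡ c ++ d →
  (∃ λ e → c ≡ a ++ e × b ≡ e ++ d) ⊎ (∃ λ e → a ≡ c ++ e × d ≡ e ++ b)
levi []      b c       d eq = inj₁ (c , refl , eq)
levi (x ∷ a) b []      d eq = inj₂ (x ∷ a , refl , sym eq)
levi (x ∷ a) b (y ∷ c) d eq with ∷-injective eq
... | refl , eq′ with levi a b c d eq′
...   | inj₁ (e , p , q) = inj₁ (e , cong (x ∷_) p , q)
...   | inj₂ (e , p , q) = inj₂ (e , cong (x ∷_) p , q)

hors-++ : ∀ a b → hors (a ++ b) ≡ hors a + hors b
hors-++ []        b = refl
hors-++ (up ∷ a)  b = hors-++ a b
hors-++ (hor ∷ a) b = cong suc (hors-++ a b)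

ups-++ : ∀ a b → ups (a ++ b) ≡ ups a + ups b
ups-++ []        b = refl
ups-++ (up ∷ a)  b = cong suc (ups-++ a b)
ups-++ (hor ∷ a) b = ups-++ a b

module Encoding (m : ℕ) where

  data Prim : Set where
    prim : Vec (List Prim) m → Prim

  Forest : Set
  Forest = List Prim

  mutual
    forestPath : Forest → Word
    forestPath []             = []
    forestPath (prim ks ∷ ps) = up ∷ (kidsPath ks ++ forestPath ps)

    kidsPath : ∀ {k} → Vec Forest k → Word
    kidsPath []       = []
    kidsPath (F ∷ Fs) = kidsPath Fs ++ (forestPath F ++ [ hor ])

  primPath : Prim → Word
  primPath (prim ks) = up ∷ kidsPath ks

  forestPath-++ : ∀ A B → forestPath (A ++ B) ≡ forestPath A ++ forestPath B
  forestPath-++ []             B = refl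
  forestPath-++ (prim ks ∷ A) B = cong (up ∷_) (begin
    kidsPath ks ++ forestPath (A ++ B)               ≡⟨ cong (kidsPath ks ++_) (forestPath-++ A B) ⟩
    kidsPath ks ++ (forestPath A ++ forestPath B)    ≡⟨ ++-assoc (kidsPath ks) _ _ ⟨
    (kidsPath ks ++ forestPath A) ++ forestPath B    ∎)
    where open ≡-Reasoning

  forestPath-∷ : ∀ p A x → forestPath (p ∷ A) ++ x ≡ primPath p ++ (forestPath A ++ x)
  forestPath-∷ (prim ks) A x = cong (up ∷_) (++-assoc (kidsPath ks) (forestPath A) x)

  forestPath-∷ʳ : ∀ F q → forestPath (F ++ [ q ]) ≡ forestPath F ++ primPath q
  forestPath-∷ʳ F (prim ks) =
    trans (forestPath-++ F [ prim ks ]) (cong (λ w → forestPath F ++ up ∷ w) (++-identityʳ _))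

  mutual
    forestSize : Forest → ℕ
    forestSize []             = 0
    forestSize (prim ks ∷ ps) = suc (kidsSize ks + forestSize ps)

    kidsSize : ∀ {k} → Vec Forest k → ℕ
    kidsSize []       = 0
    kidsSize (F ∷ Fs) = forestSize F + kidsSize Fs

  forestSize-++ : ∀ A B → forestSize (A ++ B) ≡ forestSize A + forestSize B
  forestSize-++ []             B = refl
  forestSize-++ (prim ks ∷ A) B =
    cong suc (trans (cong (kidsSize ks +_) (forestSize-++ A B)) (sym (+-assoc (kidsSize ks) _ _)))

  mutual
    toForest : Tree m → Forest
    toForest leaf        = []
    toForest (node l rs) = toForest l ++ [ prim (toKids rs) ]

    toKids : ∀ {k} → Vec (Tree m) k → Vec Forest k
    toKids []       = []
    toKids (r ∷ rs) = toForest r ∷ toKids rs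

  mutual
    fromForestOnto : Tree m → Forest → Tree m
    fromForestOnto t []             = t
    fromForestOnto t (prim ks ∷ ps) = fromForestOnto (node t (fromKids ks)) ps

    fromKids : ∀ {k} → Vec Forest k → Vec (Tree m) k
    fromKids []       = []
    fromKids (F ∷ Fs) = fromForestOnto leaf F ∷ fromKids Fs

  fromForest : Forest → Tree m
  fromForest = fromForestOnto leaf

  graft : Tree m → Tree m → Tree m
  graft t leaf        = t
  graft t (node l rs) = node (graft t l) rs

  graft-leaf : ∀ t → graft leaf t ≡ t
  graft-leaf leaf        = refl
  graft-leaf (node l rs) = cong (λ l′ → node l′ rs) (graft-leaf l)

  fromForestOnto-++ : ∀ t A B → fromForestOnto t (A ++ B) ≡ fromForestOnto (fromForestOnto t A) B
  fromForestOnto-++ t []             B = refl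
  fromForestOnto-++ t (prim ks ∷ A) B = fromForestOnto-++ _ A B

  mutual
    fromForestOnto-toForest : ∀ t u → fromForestOnto t (toForest u) ≡ graft t u
    fromForestOnto-toForest t leaf        = refl
    fromForestOnto-toForest t (node l rs)
      rewrite fromForestOnto-++ t (toForest l) [ prim (toKids rs) ]
            | fromForestOnto-toForest t l | fromKids-toKids rs = refl

    fromKids-toKids : ∀ {k} (rs : Vec (Tree m) k) → fromKids (toKids rs) ≡ rs
    fromKids-toKids []       = refl
    fromKids-toKids (r ∷ rs)
      rewrite fromForestOnto-toForest leaf r | graft-leaf r | fromKids-toKids rs = refl

  mutual
    toForest-fromForestOnto : ∀ t F → toForest (fromForestOnto t F) ≡ toForest t ++ F
    toForest-fromForestOnto t []             = sym (++-identityʳ _)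
    toForest-fromForestOnto t (prim ks ∷ ps)
      rewrite toForest-fromForestOnto (node t (fromKids ks)) ps | toKids-fromKids ks =
      ++-assoc (toForest t) _ _

    toKids-fromKids : ∀ {k} (Fs : Vec Forest k) → toKids (fromKids Fs) ≡ Fs
    toKids-fromKids []       = refl
    toKids-fromKids (F ∷ Fs) rewrite toForest-fromForestOnto leaf F | toKids-fromKids Fs = refl

  toForest-fromForest : ∀ F → toForest (fromForest F) ≡ F
  toForest-fromForest = toForest-fromForestOnto leaf

  fromForest-toForest : ∀ t → fromForest (toForest t) ≡ t
  fromForest-toForest t = trans (fromForestOnto-toForest leaf t) (graft-leaf t)

  fromForest-injective : ∀ {A B} → fromForest A ≡ fromForest B → A ≡ B
  fromForest-injective {A} {B} e =
    trans (sym (toForest-fromForest A)) (trans (cong toForest e) (toForest-fromForest B))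

  mutual
    path-toForest : ∀ t → path t ≡ forestPath (toForest t)
    path-toForest leaf        = refl
    path-toForest (node l rs)
      rewrite forestPath-++ (toForest l) [ prim (toKids rs) ] | path-toForest l | pathR-toKids rs
            | ++-identityʳ (kidsPath (toKids rs)) = refl

    pathR-toKids : ∀ {k} (rs : Vec (Tree m) k) → pathR rs ≡ kidsPath (toKids rs)
    pathR-toKids []       = refl
    pathR-toKids (r ∷ rs) rewrite pathR-toKids rs | path-toForest r = refl

  mutual
    size-toForest : ∀ t → size t ≡ forestSize (toForest t)
    size-toForest leaf        = refl
    size-toForest (node l rs)
      rewrite forestSize-++ (toForest l) [ prim (toKids rs) ] | size-toForest l | sizes-toKids rs
            | +-identityʳ (kidsSize (toKids rs)) = sym (+-suc _ _)

    sizes-toKids : ∀ {k} (rs : Vec (Tree m) k) → sizes rs ≡ kidsSize (toKids rs)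
    sizes-toKids []       = refl
    sizes-toKids (r ∷ rs) rewrite size-toForest r | sizes-toKids rs = refl

  leftBranch-toForest : ∀ t → leftBranch t ≡ length (toForest t)
  leftBranch-toForest leaf        = refl
  leftBranch-toForest (node l rs)
    rewrite length-++ (toForest l) {[ prim (toKids rs) ]} | leftBranch-toForest l = +-comm 1 _

  Above : ℕ → Word → Set
  Above h w = ∀ u v → w ≡ u ++ v → hors u ≤ h + m * ups u

  Above-mono : ∀ {h h′ w} → h ≤ h′ → Above h w → Above h′ w
  Above-mono h≤h′ ab u v e = ≤-trans (ab u v e) (+-monoˡ-≤ _ h≤h′)

  Above-[] : ∀ {h} → Above h []
  Above-[] [] [] refl = z≤n

  Above-hor : Above 1 [ hor ]
  Above-hor []            v        e  = z≤n
  Above-hor (hor ∷ [])    v        e  = s≤s z≤n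
  Above-hor (hor ∷ _ ∷ _) v        ()

  Above-up : ∀ {h w} → Above (m + h) w → Above h (up ∷ w)
  Above-up ab []       v e = z≤n
  Above-up {h} ab (up ∷ u) v e =
    ≤-trans (ab u v (∷-injectiveʳ e)) (≤-reflexive (shift m h (ups u)))
    where
      shift : ∀ m h a → m + h + m * a ≡ h + m * suc a
      shift = solve-∀
  Above-up ab (hor ∷ u) v ()

  Above-++ : ∀ {h d a b} → Above h a → hors a + d ≡ h + m * ups a → Above d b → Above h (a ++ b)
  Above-++ {h} {d} {a} {b} aa bal ab u v e with levi u v a b (sym e)
  ... | inj₁ (x , p , _) = aa u x p
  ... | inj₂ (x , refl , q) = begin
    hors (a ++ x)                  ≡⟨ hors-++ a x ⟩
    hors a + hors x                ≤⟨ +-monoʳ-≤ (hors a) (ab x v q) ⟩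
    hors a + (d + m * ups x)       ≡⟨ +-assoc (hors a) d _ ⟨
    hors a + d + m * ups x         ≡⟨ cong (_+ m * ups x) bal ⟩
    h + m * ups a + m * ups x      ≡⟨ regroup h m (ups a) (ups x) ⟩
    h + m * (ups a + ups x)        ≡⟨ cong (λ z → h + m * z) (ups-++ a x) ⟨
    h + m * ups (a ++ x)           ∎
    where
      open ≤-Reasoning
      regroup : ∀ h m a x → h + m * a + m * x ≡ h + m * (a + x)
      regroup = solve-∀

  mutual
    forestPath-balanced : ∀ F → hors (forestPath F) ≡ m * ups (forestPath F)
    forestPath-balanced []             = sym (*-zeroʳ m)
    forestPath-balanced (prim ks ∷ ps)
      rewrite hors-++ (kidsPath ks) (forestPath ps) | ups-++ (kidsPath ks) (forestPath ps)
            | kidsPath-hors ks | forestPath-balanced ps = regroup m (ups (kidsPath ks)) (ups (forestPath ps))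
      where
        regroup : ∀ m a b → m + m * a + m * b ≡ m * suc (a + b)
        regroup = solve-∀

    kidsPath-hors : ∀ {k} (ks : Vec Forest k) → hors (kidsPath ks) ≡ k + m * ups (kidsPath ks)
    kidsPath-hors []                 = sym (*-zeroʳ m)
    kidsPath-hors {suc k} (F ∷ Fs)
      rewrite hors-++ (kidsPath Fs) (forestPath F ++ [ hor ]) | ups-++ (kidsPath Fs) (forestPath F ++ [ hor ])
            | hors-++ (forestPath F) [ hor ] | ups-++ (forestPath F) [ hor ]
            | kidsPath-hors Fs | forestPath-balanced F = regroup k m (ups (kidsPath Fs)) (ups (forestPath F))
      where
        regroup : ∀ k m a b → k + m * a + (m * b + 1) ≡ suc (k + m * (a + (b + 0)))
        regroup = solve-∀

  primPath-balanced : ∀ p → hors (primPath p) ≡ m * ups (primPath p)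
  primPath-balanced (prim ks) = trans (kidsPath-hors ks) (sym (*-suc m (ups (kidsPath ks))))

  mutual
    forestPath-above : ∀ F → Above 0 (forestPath F)
    forestPath-above []             = Above-[]
    forestPath-above (prim ks ∷ ps) =
      Above-up (Above-++ (Above-mono (m≤m+n m 0) (kidsPath-above ks))
                         (trans (+-identityʳ _)
                           (trans (kidsPath-hors ks) (cong (_+ m * ups (kidsPath ks)) (sym (+-identityʳ m)))))
                         (forestPath-above ps))

    kidsPath-above : ∀ {k} (ks : Vec Forest k) → Above k (kidsPath ks)
    kidsPath-above []               = Above-[]
    kidsPath-above {suc k} (F ∷ Fs) =
      Above-++ (Above-mono (n≤1+n k) (kidsPath-above Fs)) (trans (+-comm _ 1) (cong suc (kidsPath-hors Fs)))
        (Above-++ (Above-mono z≤n (forestPath-above F)) (trans (+-comm _ 1) (cong suc (forestPath-balanced F)))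
          Above-hor)

  forestPath-hor-prefix-above : ∀ F u v → u ++ v ≡ forestPath F ++ [ hor ] → v ≢ [] → hors u ≤ m * ups u
  forestPath-hor-prefix-above F u v eq v≢[] with levi u v (forestPath F) [ hor ] eq
  ... | inj₁ (x , p , _)           = forestPath-above F u x p
  ... | inj₂ ([] , p , _)          = ≤-reflexive (subst (λ w → hors w ≡ m * ups w)
                                                  (trans (sym (++-identityʳ _)) (sym p)) (forestPath-balanced F))
  ... | inj₂ (_ ∷ x , _ , q) = ⊥-elim (v≢[] (++-conicalʳ x v (sym (∷-injectiveʳ q))))

  kidsPath-strict : ∀ {k} (ks : Vec Forest k) u v → kidsPath ks ≡ u ++ v → v ≢ [] → hors u < k + m * ups u
  kidsPath-strict []       [] [] e v≢[] = ⊥-elim (v≢[] refl)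
  kidsPath-strict {suc k} (F ∷ Fs) u v e v≢[] with levi (kidsPath Fs) (forestPath F ++ [ hor ]) u v e
  ... | inj₂ (x , p , _)    = s≤s (kidsPath-above Fs u x p)
  ... | inj₁ (x , refl , q)
    rewrite hors-++ (kidsPath Fs) x | ups-++ (kidsPath Fs) x | kidsPath-hors Fs =
    s≤s (≤-trans (+-monoʳ-≤ (k + m * ups (kidsPath Fs)) (forestPath-hor-prefix-above F x v (sym q) v≢[]))
                 (≤-reflexive (regroup k m (ups (kidsPath Fs)) (ups x))))
    where
      regroup : ∀ k m a b → k + m * a + m * b ≡ k + m * (a + b)
      regroup = solve-∀

  primPath-primitive : ∀ p → IsPrimitive m (primPath p)
  primPath-primitive (prim ks) =
    (λ ()) , (primPath-balanced (prim ks) , Above-up (Above-mono (m≤m+n m 0) (kidsPath-above ks))) , strict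
    where
      strict : ∀ u v → up ∷ kidsPath ks ≡ u ++ v → u ≢ [] → v ≢ [] → hors u < m * ups u
      strict []       v e u≢[] v≢[] = ⊥-elim (u≢[] refl)
      strict (up ∷ u) v e u≢[] v≢[] =
        ≤-trans (kidsPath-strict ks u v (∷-injectiveʳ e) v≢[]) (≤-reflexive (sym (*-suc m (ups u))))
      strict (hor ∷ u) v () u≢[] v≢[]

  primitive-starts-up : ∀ {c} → IsPrimitive m c → ∃ λ c′ → c ≡ up ∷ c′
  primitive-starts-up {[]}      pc = ⊥-elim (proj₁ pc refl)
  primitive-starts-up {up ∷ c}  pc = c , refl
  primitive-starts-up {hor ∷ c} (_ , (_ , above) , _) with above [ hor ] c refl
  ... | 1≤m*0 rewrite *-zeroʳ m with 1≤m*0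
  ... | ()

  -- A primitive path touches the line only at its end, so it is not a proper prefix of another one.
  primitive-prefix-unique : ∀ {c d v w} → IsPrimitive m c → IsPrimitive m d → c ++ v ≡ d ++ w → c ≡ d
  primitive-prefix-unique {c} {d} {v} {w} (c≢[] , (c-balanced , _) , c-strict) (d≢[] , (d-balanced , _) , d-strict) eq
    with levi c v d w eq
  ... | inj₁ ([] , p , _)    = sym (trans p (++-identityʳ c))
  ... | inj₁ (x ∷ e , p , _) = ⊥-elim (<-irrefl c-balanced (d-strict c (x ∷ e) p c≢[] (λ ())))
  ... | inj₂ ([] , p , _)    = trans p (++-identityʳ d)
  ... | inj₂ (x ∷ e , p , _) = ⊥-elim (<-irrefl d-balanced (c-strict d (x ∷ e) p d≢[] (λ ())))

  primitive-++≢hor∷ : ∀ {c v t} → IsPrimitive m c → c ++ v ≢ hor ∷ t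
  primitive-++≢hor∷ pc e with primitive-starts-up pc
  ... | _ , refl with e
  ...   | ()

  primitive-prefix-forestPath : ∀ {c v} q A t → IsPrimitive m c → c ++ v ≡ forestPath (q ∷ A) ++ t →
    c ≡ primPath q × v ≡ forestPath A ++ t
  primitive-prefix-forestPath {c} {v} q A t pc e with primitive-prefix-unique pc (primPath-primitive q) e′
    where e′ = trans e (forestPath-∷ q A t)
  ... | refl = refl , ++-cancelˡ c _ _ (trans e (forestPath-∷ q A t))

  NoLeadingUp : Word → Set
  NoLeadingUp w = w ≡ [] ⊎ ∃ λ w′ → w ≡ hor ∷ w′

  mutual
    forestPath-injective′ : ∀ A B x y → NoLeadingUp x → NoLeadingUp y →
      forestPath A ++ x ≡ forestPath B ++ y → A ≡ B × x ≡ y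
    forestPath-injective′ []        []        x y _ _ e = refl , e
    forestPath-injective′ []          (prim _ ∷ _) x y (inj₁ refl)       _ ()
    forestPath-injective′ []          (prim _ ∷ _) x y (inj₂ (_ , refl)) _ ()
    forestPath-injective′ (prim _ ∷ _) []          x y _ (inj₁ refl)       ()
    forestPath-injective′ (prim _ ∷ _) []          x y _ (inj₂ (_ , refl)) ()
    forestPath-injective′ (p ∷ A) (q ∷ B) x y nx ny e
      with primitive-prefix-unique (primPath-primitive p) (primPath-primitive q) e′
      where e′ = trans (sym (forestPath-∷ p A x)) (trans e (forestPath-∷ q B y))
    forestPath-injective′ (prim ks ∷ A) (prim ks′ ∷ B) x y nx ny e | p≡q
      with kidsPath-injective ks ks′ [] [] (trans (++-identityʳ _) (trans (∷-injectiveʳ p≡q) (sym (++-identityʳ _))))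
         | forestPath-injective′ A B x y nx ny
             (++-cancelˡ (primPath (prim ks)) _ _ (trans (sym (forestPath-∷ (prim ks) A x))
               (trans e (trans (forestPath-∷ (prim ks′) B y) (cong (_++ (forestPath B ++ y)) (sym p≡q))))))
    ... | refl , _ | refl , refl = refl , refl

    kidsPath-injective : ∀ {k} (Fs Gs : Vec Forest k) x y → kidsPath Fs ++ x ≡ kidsPath Gs ++ y → Fs ≡ Gs × x ≡ y
    kidsPath-injective []       []       x y e = refl , e
    kidsPath-injective (F ∷ Fs) (G ∷ Gs) x y e
      with kidsPath-injective Fs Gs (forestPath F ++ hor ∷ x) (forestPath G ++ hor ∷ y)
             (trans (sym (kidsPath-∷ Fs F x)) (trans e (kidsPath-∷ Gs G y)))
    ... | refl , e′ with forestPath-injective′ F G (hor ∷ x) (hor ∷ y) (inj₂ (x , refl)) (inj₂ (y , refl)) e′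
    ...   | refl , refl = refl , refl

    kidsPath-∷ : ∀ {k} (Fs : Vec Forest k) F x → kidsPath (F ∷ Fs) ++ x ≡ kidsPath Fs ++ (forestPath F ++ hor ∷ x)
    kidsPath-∷ Fs F x = trans (++-assoc (kidsPath Fs) _ x) (cong (kidsPath Fs ++_) (++-assoc (forestPath F) [ hor ] x))

  forestPath-injective : ∀ {A B} → forestPath A ≡ forestPath B → A ≡ B
  forestPath-injective {A} {B} e =
    proj₁ (forestPath-injective′ A B [] [] (inj₁ refl) (inj₁ refl)
             (trans (++-identityʳ _) (trans e (sym (++-identityʳ _)))))

rotAt : ∀ {m x y} u c v → IsPrimitive m c → x ≡ u ++ hor ∷ c ++ v → y ≡ u ++ c ++ hor ∷ v → Rot m x y
rotAt u c v pc refl refl = rot u c v pc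

Rot-prefix : ∀ {m x y} a → Rot m x y → Rot m (a ++ x) (a ++ y)
Rot-prefix a (rot u c v pc) = rotAt (a ++ u) c v pc (sym (++-assoc a u _)) (sym (++-assoc a u _))

Rot-suffix : ∀ {m x y} t → Rot m x y → Rot m (x ++ t) (y ++ t)
Rot-suffix t (rot u c v pc) =
  rotAt u c (v ++ t) pc (reassoc u (hor ∷ c) v t) (reassoc u c (hor ∷ v) t)
  where
    reassoc : ∀ (u c v t : Word) → (u ++ c ++ v) ++ t ≡ u ++ c ++ v ++ t
    reassoc u c v t = solve (++-monoid Step)

-- From here on the slope is suc m, so that the kid vectors are nonempty.
module Rotations (m : ℕ) where

  open Encoding (suc m)

  mutual
    data RotF : Forest → Forest → Set where
      inKids : ∀ {ks ks′ ps} → RotK ks ks′ → RotF (prim ks ∷ ps) (prim ks′ ∷ ps)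
      inTail : ∀ {p ps ps′} → RotF ps ps′ → RotF (p ∷ ps) (p ∷ ps′)
      absorb : ∀ {F Fs q ps} → RotF (prim (F ∷ Fs) ∷ q ∷ ps) (prim ((F ++ [ q ]) ∷ Fs) ∷ ps)

    data RotK : ∀ {k} → Vec Forest k → Vec Forest k → Set where
      inHead     : ∀ {k F F′} {Fs : Vec Forest k} → RotF F F′ → RotK (F ∷ Fs) (F′ ∷ Fs)
      inRest     : ∀ {k F} {Fs Fs′ : Vec Forest k} → RotK Fs Fs′ → RotK (F ∷ Fs) (F ∷ Fs′)
      absorbNext : ∀ {k q G F} {Fs : Vec Forest k} → RotK ((q ∷ G) ∷ F ∷ Fs) (G ∷ (F ++ [ q ]) ∷ Fs)

  absorbing-path : ∀ F Fs q ps t → forestPath (prim (F ∷ Fs) ∷ q ∷ ps) ++ t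
    ≡ up ∷ ((kidsPath Fs ++ forestPath F) ++ hor ∷ primPath q ++ (forestPath ps ++ t))
  absorbing-path F Fs (prim qs) ps t =
    cong (up ∷_) (reassoc (kidsPath Fs) (forestPath F) [ hor ] [ up ] (kidsPath qs) (forestPath ps) t)
    where
      -- [ hor ] and [ up ] are abstracted, as the monoid solver does not see single letters as atoms.
      reassoc : ∀ (K E H U Q P t : Word) →
        ((K ++ (E ++ H)) ++ (U ++ (Q ++ P))) ++ t ≡ (K ++ E) ++ (H ++ ((U ++ Q) ++ (P ++ t)))
      reassoc K E H U Q P t = solve (++-monoid Step)

  absorbed-path : ∀ F Fs q ps t → forestPath (prim ((F ++ [ q ]) ∷ Fs) ∷ ps) ++ t
    ≡ up ∷ ((kidsPath Fs ++ forestPath F) ++ primPath q ++ hor ∷ (forestPath ps ++ t))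
  absorbed-path F Fs q@(prim qs) ps t rewrite forestPath-∷ʳ F q =
    cong (up ∷_) (reassoc (kidsPath Fs) (forestPath F) [ hor ] [ up ] (kidsPath qs) (forestPath ps) t)
    where
      reassoc : ∀ (K E H U Q P t : Word) →
        ((K ++ ((E ++ (U ++ Q)) ++ H)) ++ P) ++ t ≡ (K ++ E) ++ ((U ++ Q) ++ (H ++ (P ++ t)))
      reassoc K E H U Q P t = solve (++-monoid Step)

  absorbingNext-path : ∀ q G F {k} (Fs : Vec Forest k) t → kidsPath ((q ∷ G) ∷ F ∷ Fs) ++ t
    ≡ (kidsPath Fs ++ forestPath F) ++ hor ∷ primPath q ++ (forestPath G ++ hor ∷ t)
  absorbingNext-path (prim qs) G F Fs t =
    reassoc (kidsPath Fs) (forestPath F) [ hor ] [ up ] (kidsPath qs) (forestPath G) t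
    where
      reassoc : ∀ (K E H U Q G t : Word) →
        ((K ++ (E ++ H)) ++ ((U ++ (Q ++ G)) ++ H)) ++ t ≡ (K ++ E) ++ (H ++ ((U ++ Q) ++ (G ++ (H ++ t))))
      reassoc K E H U Q G t = solve (++-monoid Step)

  absorbedNext-path : ∀ q G F {k} (Fs : Vec Forest k) t → kidsPath (G ∷ (F ++ [ q ]) ∷ Fs) ++ t
    ≡ (kidsPath Fs ++ forestPath F) ++ primPath q ++ hor ∷ (forestPath G ++ hor ∷ t)
  absorbedNext-path q@(prim qs) G F Fs t rewrite forestPath-∷ʳ F q =
    reassoc (kidsPath Fs) (forestPath F) [ hor ] [ up ] (kidsPath qs) (forestPath G) t
    where
      reassoc : ∀ (K E H U Q G t : Word) →
        ((K ++ ((E ++ (U ++ Q)) ++ H)) ++ (G ++ H)) ++ t ≡ (K ++ E) ++ ((U ++ Q) ++ (H ++ (G ++ (H ++ t))))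
      reassoc K E H U Q G t = solve (++-monoid Step)

  mutual
    RotF⇒Rot : ∀ {F F′} → RotF F F′ → Rot (suc m) (forestPath F) (forestPath F′)
    RotF⇒Rot (inKids {ps = ps} r) = Rot-prefix [ up ] (Rot-suffix (forestPath ps) (RotK⇒Rot r))
    RotF⇒Rot (inTail {p = prim ks} r) = Rot-prefix (up ∷ kidsPath ks) (RotF⇒Rot r)
    RotF⇒Rot (absorb {F} {Fs} {q} {ps}) =
      rotAt (up ∷ (kidsPath Fs ++ forestPath F)) (primPath q) (forestPath ps ++ []) (primPath-primitive q)
        (trans (sym (++-identityʳ _)) (absorbing-path F Fs q ps []))
        (trans (sym (++-identityʳ _)) (absorbed-path F Fs q ps []))

    RotK⇒Rot : ∀ {k} {Fs Fs′ : Vec Forest k} → RotK Fs Fs′ → Rot (suc m) (kidsPath Fs) (kidsPath Fs′)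
    RotK⇒Rot (inHead {Fs = Fs} r) = Rot-prefix (kidsPath Fs) (Rot-suffix [ hor ] (RotF⇒Rot r))
    RotK⇒Rot (inRest {F = F} r) = Rot-suffix (forestPath F ++ [ hor ]) (RotK⇒Rot r)
    RotK⇒Rot (absorbNext {q = q} {G} {F} {Fs}) =
      rotAt (kidsPath Fs ++ forestPath F) (primPath q) (forestPath G ++ [ hor ]) (primPath-primitive q)
        (trans (sym (++-identityʳ _)) (absorbingNext-path q G F Fs []))
        (trans (sym (++-identityʳ _)) (absorbedNext-path q G F Fs []))

  -- How the letter hor moved by a rotation  enc a ++ t = u ++ hor ∷ c ++ v  sits relative to enc a.
  data Located {A : Set} (R : A → A → Set) (enc : A → Word) (a : A) (t u c v : Word) : Set where
    inside : ∀ {a′} → R a a′ → enc a′ ++ t ≡ u ++ c ++ hor ∷ v → Located R enc a t u c v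
    after  : ∀ u′ → u ≡ enc a ++ u′ → Located R enc a t u c v
    atEnd  : u ++ [ hor ] ≡ enc a → Located R enc a t u c v

  LocatedF : Forest → Word → Word → Word → Word → Set
  LocatedF = Located RotF forestPath

  LocatedK : ∀ {k} → Vec Forest k → Word → Word → Word → Word → Set
  LocatedK = Located RotK kidsPath

  cancel-closing : ∀ u {w x y} → u ++ [ hor ] ≡ w → w ++ x ≡ u ++ hor ∷ y → x ≡ y
  cancel-closing u refl e = ∷-injectiveʳ (++-cancelˡ u _ _ (trans (sym (++-assoc u [ hor ] _)) e))

  locateF-closingKid : ∀ ks ps t u c v → IsPrimitive (suc m) c →
    u ++ [ hor ] ≡ kidsPath ks → c ++ v ≡ forestPath ps ++ t → LocatedF (prim ks ∷ ps) t (up ∷ u) c v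
  locateF-closingKid ks []       t u c v pc eq _ = atEnd (cong (up ∷_) (trans eq (sym (++-identityʳ _))))
  locateF-closingKid (F ∷ Fs) (q ∷ ps) t u c v pc eq e
    with primitive-prefix-forestPath q ps t pc e
       | ++-cancelʳ [ hor ] u _ (trans eq (sym (++-assoc (kidsPath Fs) (forestPath F) [ hor ])))
  ... | refl , refl | refl = inside absorb (absorbed-path F Fs q ps t)

  locateK-closingNext : ∀ F {k} (Fs : Vec Forest k) t u c v → IsPrimitive (suc m) c →
    u ++ [ hor ] ≡ kidsPath Fs → forestPath F ++ hor ∷ t ≡ c ++ v → LocatedK (F ∷ Fs) t u c v
  locateK-closingNext F       []         t u c v pc eq e with ++-conicalʳ u [ hor ] eq
  ... | ()
  locateK-closingNext []      (_ ∷ _)    t u c v pc eq e = ⊥-elim (primitive-++≢hor∷ pc (sym e))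
  locateK-closingNext (q ∷ G) (F ∷ Fs) t u c v pc eq e
    with primitive-prefix-forestPath q G (hor ∷ t) pc (sym e)
       | ++-cancelʳ [ hor ] u _ (trans eq (sym (++-assoc (kidsPath Fs) (forestPath F) [ hor ])))
  ... | refl , refl | refl = inside absorbNext (absorbedNext-path q G F Fs t)

  locateK-afterKid : ∀ F {k} (Fs : Vec Forest k) t u c v → hor ∷ t ≡ u ++ hor ∷ c ++ v →
    LocatedK (F ∷ Fs) t (kidsPath Fs ++ (forestPath F ++ u)) c v
  locateK-afterKid F Fs t []        c v e = atEnd (reassoc (kidsPath Fs) (forestPath F) [ hor ])
    where
      reassoc : ∀ (K E H : Word) → (K ++ (E ++ [])) ++ H ≡ K ++ (E ++ H)
      reassoc K E H = solve (++-monoid Step)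
  locateK-afterKid F Fs t (hor ∷ u) c v e = after u (reassoc (kidsPath Fs) (forestPath F) [ hor ] u)
    where
      reassoc : ∀ (K E H u : Word) → K ++ (E ++ (H ++ u)) ≡ (K ++ (E ++ H)) ++ u
      reassoc K E H u = solve (++-monoid Step)

  mutual
    locateF : ∀ F t u c v → IsPrimitive (suc m) c → forestPath F ++ t ≡ u ++ hor ∷ c ++ v → LocatedF F t u c v
    locateF []             t u         c v pc e  = after u refl
    locateF (prim ks ∷ ps) t (up ∷ u)  c v pc e
      with locateK ks (forestPath ps ++ t) u c v pc e′
      where e′ = trans (sym (++-assoc (kidsPath ks) _ t)) (∷-injectiveʳ e)
    ... | inside r eq  = inside (inKids r) (cong (up ∷_) (trans (++-assoc _ (forestPath ps) t) eq))
    ... | atEnd eq     = locateF-closingKid ks ps t u c v pc eq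
                           (sym (cancel-closing u eq (trans (sym (++-assoc (kidsPath ks) _ t)) (∷-injectiveʳ e))))
    ... | after u₁ refl = locateF-inTail ks ps t u₁ c v pc
                            (++-cancelˡ (kidsPath ks) _ _ (trans (sym (++-assoc (kidsPath ks) _ t))
                              (trans (∷-injectiveʳ e) (++-assoc (kidsPath ks) u₁ _))))

    locateF-inTail : ∀ ks ps t u c v → IsPrimitive (suc m) c →
      forestPath ps ++ t ≡ u ++ hor ∷ c ++ v → LocatedF (prim ks ∷ ps) t (up ∷ (kidsPath ks ++ u)) c v
    locateF-inTail ks ps t u c v pc e with locateF ps t u c v pc e
    ... | inside r eq   = inside (inTail r) (cong (up ∷_) (trans (++-assoc (kidsPath ks) _ t)
                            (trans (cong (kidsPath ks ++_) eq) (sym (++-assoc (kidsPath ks) u _)))))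
    ... | after u′ refl = after u′ (cong (up ∷_) (sym (++-assoc (kidsPath ks) (forestPath ps) u′)))
    ... | atEnd eq      = atEnd (cong (up ∷_) (trans (++-assoc (kidsPath ks) u [ hor ]) (cong (kidsPath ks ++_) eq)))

    locateK : ∀ {k} (Fs : Vec Forest k) t u c v → IsPrimitive (suc m) c → kidsPath Fs ++ t ≡ u ++ hor ∷ c ++ v →
      LocatedK Fs t u c v
    locateK []       t u c v pc e = after u refl
    locateK (F ∷ Fs) t u c v pc e with locateK Fs (forestPath F ++ hor ∷ t) u c v pc (trans (sym (kidsPath-∷ Fs F t)) e)
    ... | inside {Fs′} r eq = inside (inRest r) (trans (kidsPath-∷ Fs′ F t) eq)
    ... | atEnd eq      = locateK-closingNext F Fs t u c v pc eq (cancel-closing u eq (trans (sym (kidsPath-∷ Fs F t)) e))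
    ... | after u₁ refl = locateK-inHead F Fs t u₁ c v pc
                            (++-cancelˡ (kidsPath Fs) _ _ (trans (sym (kidsPath-∷ Fs F t)) (trans e (++-assoc (kidsPath Fs) u₁ _))))

    locateK-inHead : ∀ F {k} (Fs : Vec Forest k) t u c v → IsPrimitive (suc m) c →
      forestPath F ++ hor ∷ t ≡ u ++ hor ∷ c ++ v → LocatedK (F ∷ Fs) t (kidsPath Fs ++ u) c v
    locateK-inHead F Fs t u c v pc e with locateF F (hor ∷ t) u c v pc e
    ... | inside r eq   = inside (inHead r) (trans (kidsPath-∷ Fs _ t)
                            (trans (cong (kidsPath Fs ++_) eq) (sym (++-assoc (kidsPath Fs) u _))))
    ... | atEnd eq      = ⊥-elim (primitive-++≢hor∷ pc (sym (cancel-closing u eq e)))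
    ... | after u′ refl = locateK-afterKid F Fs t u′ c v
                            (++-cancelˡ (forestPath F) _ _ (trans e (++-assoc (forestPath F) u′ _)))

  Rot⇒RotF : ∀ F {x z} → x ≡ forestPath F → Rot (suc m) x z → ∃ λ F′ → RotF F F′ × z ≡ forestPath F′
  Rot⇒RotF F e (rot u c v pc) with locateF F [] u c v pc e′
    where e′ = trans (++-identityʳ _) (sym e)
  ... | inside r eq   = _ , r , trans (sym eq) (++-identityʳ _)
  ... | after u′ refl
    with ++-conicalʳ u′ _ (++-identityʳ-unique (forestPath F) (trans (sym e) (++-assoc (forestPath F) u′ _)))
  ...   | ()
  Rot⇒RotF F e (rot u c v pc) | atEnd eq =
    ⊥-elim (proj₁ pc (++-conicalˡ c v (sym (cancel-closing u eq (trans (++-identityʳ _) (sym e))))))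

  -- BelowKids Gs c Fs: the kids Gs lie below Fs once the spill c, pushed out past the first kid, is removed.
  mutual
    data Below : Forest → Forest → Set where
      []  : Below [] []
      _∷_ : ∀ {Gs c ks r ps} → BelowKids Gs c ks → Below r ps → Below (prim Gs ∷ (c ++ r)) (prim ks ∷ ps)

    data BelowKids : ∀ {k} → Vec Forest k → Forest → Vec Forest k → Set where
      []  : BelowKids [] [] []
      cut : ∀ {k} {Gs Fs : Vec Forest k} {c q F a b} →
            BelowKids Gs c Fs → Below q F → a ++ b ≡ c ++ q → BelowKids (a ∷ Gs) b (F ∷ Fs)

  mutual
    Below-refl : ∀ F → Below F F
    Below-refl []             = []
    Below-refl (prim ks ∷ ps) = BelowKids-refl ks ∷ Below-refl ps

    BelowKids-refl : ∀ {k} (ks : Vec Forest k) → BelowKids ks [] ks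
    BelowKids-refl []       = []
    BelowKids-refl (F ∷ Fs) = cut (BelowKids-refl Fs) (Below-refl F) (++-identityʳ F)

  RotF-++ʳ : ∀ {a a′} b → RotF a a′ → RotF (a ++ b) (a′ ++ b)
  RotF-++ʳ b (inKids r) = inKids r
  RotF-++ʳ b (inTail r) = inTail (RotF-++ʳ b r)
  RotF-++ʳ b absorb     = absorb

  RotF-++ˡ : ∀ a {b b′} → RotF b b′ → RotF (a ++ b) (a ++ b′)
  RotF-++ˡ []      r = r
  RotF-++ˡ (_ ∷ a) r = inTail (RotF-++ˡ a r)

  RotF-++⁻ : ∀ {G} q r → RotF G (q ++ r) →
    (∃ λ q₀ → RotF q₀ q × G ≡ q₀ ++ r) ⊎ (∃ λ r₀ → RotF r₀ r × G ≡ q ++ r₀)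
  RotF-++⁻ []      r ρ                    = inj₂ (_ , ρ , refl)
  RotF-++⁻ (_ ∷ q) r (inKids {ks} rk)      = inj₁ (prim ks ∷ q , inKids rk , refl)
  RotF-++⁻ (_ ∷ q) r (absorb {F} {Fs} {p}) = inj₁ (prim (F ∷ Fs) ∷ p ∷ q , absorb , refl)
  RotF-++⁻ (_ ∷ q) r (inTail {p} ρ) with RotF-++⁻ q r ρ
  ... | inj₁ (q₀ , ρ′ , refl) = inj₁ (p ∷ q₀ , inTail ρ′ , refl)
  ... | inj₂ (r₀ , ρ′ , refl) = inj₂ (r₀ , ρ′ , refl)

  mutual
    Below-pred : ∀ {G G′ F} → RotF G G′ → Below G′ F → Below G F
    Below-pred ρ (_∷_ {Gs} {c} {r = r} bk b) with RotF-++⁻ (prim Gs ∷ c) r ρ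
    ... | inj₂ (r₀ , ρ′ , refl) = bk ∷ Below-pred ρ′ b
    ... | inj₁ (q₀ , ρ′ , refl) = Below-pred-prim ρ′ bk b

    Below-pred-prim : ∀ {q₀ Gs c ks r ps} → RotF q₀ (prim Gs ∷ c) → BelowKids Gs c ks → Below r ps →
      Below (q₀ ++ r) (prim ks ∷ ps)
    Below-pred-prim (inKids rk) bk b = BelowKids-pred-kids rk bk ∷ b
    Below-pred-prim (inTail ρ) bk b = BelowKids-pred-spill bk ρ ∷ b
    Below-pred-prim (absorb {F} {q = p} {c}) (cut bk bq eq) b =
      cut bk bq (trans (sym (++-assoc F [ p ] c)) eq) ∷ b

    BelowKids-pred-spill : ∀ {k} {Gs Fs : Vec Forest k} {c c₀} → BelowKids Gs c Fs → RotF c₀ c → BelowKids Gs c₀ Fs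
    BelowKids-pred-spill (cut {c = c} {q} {a = a} bk bq eq) ρ
      with RotF-++⁻ c q (subst (RotF _) eq (RotF-++ˡ a ρ))
    ... | inj₁ (c₀ , ρ′ , eq′) = cut (BelowKids-pred-spill bk ρ′) bq eq′
    ... | inj₂ (q₀ , ρ′ , eq′) = cut bk (Below-pred ρ′ bq) eq′

    BelowKids-pred-kids : ∀ {k} {Gs₀ Gs Fs : Vec Forest k} {c} → RotK Gs₀ Gs → BelowKids Gs c Fs → BelowKids Gs₀ c Fs
    BelowKids-pred-kids (inHead ρ) (cut {c = c} {q} {b = b} bk bq eq)
      with RotF-++⁻ c q (subst (RotF _) eq (RotF-++ʳ b ρ))
    ... | inj₁ (c₀ , ρ′ , eq′) = cut (BelowKids-pred-spill bk ρ′) bq eq′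
    ... | inj₂ (q₀ , ρ′ , eq′) = cut bk (Below-pred ρ′ bq) eq′
    BelowKids-pred-kids (inRest rk) (cut bk bq eq) = cut (BelowKids-pred-kids rk bk) bq eq
    BelowKids-pred-kids (absorbNext {q = p} {F = F}) (cut {c = c} (cut bk₂ bq₂ eq₂) bq eq) =
      cut (cut bk₂ bq₂ (trans (sym (++-assoc F [ p ] c)) eq₂)) bq (cong (p ∷_) eq)

  Star⇒Below : ∀ G {F x y} → x ≡ forestPath G → y ≡ forestPath F → Star (Rot (suc m)) x y → Below G F
  Star⇒Below G {F} ex ey ε = subst (λ H → Below H F) (forestPath-injective (trans (sym ey) ex)) (Below-refl F)
  Star⇒Below G ex ey (r ◅ rs) with Rot⇒RotF G ex r
  ... | G′ , ρ , ez = Below-pred ρ (Star⇒Below G′ ez ey rs)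

  -- The rotations of a kid vector  X ∷ Ks  are those of the forest  prim Ks ∷ X : the first kid X plays
  -- the part of the forest following the primitive.
  RotK⇒RotF-prim : ∀ {v v′ : Vec Forest (suc (suc m))} → RotK v v′ →
    RotF (prim (Vec.tail v) ∷ Vec.head v) (prim (Vec.tail v′) ∷ Vec.head v′)
  RotK⇒RotF-prim (inHead ρ)  = inTail ρ
  RotK⇒RotF-prim (inRest rk) = inKids rk
  RotK⇒RotF-prim absorbNext  = absorb

  absorbAll : ∀ {k} b X a (Gs : Vec Forest k) → Star RotK ((b ++ X) ∷ a ∷ Gs) (X ∷ (a ++ b) ∷ Gs)
  absorbAll []      X a Gs rewrite ++-identityʳ a = ε
  absorbAll (p ∷ b) X a Gs =
    absorbNext ◅ subst (λ z → Star RotK ((b ++ X) ∷ (a ++ [ p ]) ∷ Gs) (X ∷ z ∷ Gs))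
                       (++-assoc a [ p ] b) (absorbAll b X (a ++ [ p ]) Gs)

  mutual
    Below⇒Star : ∀ {G F} → Below G F → Star RotF G F
    Below⇒Star [] = ε
    Below⇒Star (_∷_ {Gs} {c} {ks} {r} bk b) =
      gmap (_++ r) (RotF-++ʳ r) (BelowKids⇒Star-prim bk) ◅◅ gmap (prim ks ∷_) inTail (Below⇒Star b)

    BelowKids⇒Star-prim : ∀ {Gs c ks} → BelowKids Gs c ks → Star RotF (prim Gs ∷ c) (prim ks ∷ [])
    BelowKids⇒Star-prim {Gs} {c} {ks} bk =
      subst (λ z → Star RotF (prim Gs ∷ z) (prim ks ∷ [])) (++-identityʳ c)
        (gmap (λ v → prim (Vec.tail v) ∷ Vec.head v) RotK⇒RotF-prim (BelowKids⇒Star bk []))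

    BelowKids⇒Star : ∀ {k} {Gs Fs : Vec Forest k} {c} → BelowKids Gs c Fs → ∀ X → Star RotK ((c ++ X) ∷ Gs) (X ∷ Fs)
    BelowKids⇒Star [] X = ε
    BelowKids⇒Star (cut {Gs = Gs} {Fs} {c} {q} {F} {a} {b} bk bq eq) X =
      absorbAll b X a Gs ◅◅ subst (λ z → Star RotK (X ∷ z ∷ Gs) (X ∷ F ∷ Fs)) (sym eq)
        (gmap (X ∷_) inRest (BelowKids⇒Star bk q)
          ◅◅ gmap (λ z → X ∷ z ∷ Fs) (inRest ∘ inHead) (Below⇒Star bq))

infix 4 _≈_
record _≈_ (p q : Poly) : Set where
  constructor coeffwise
  field coeff-≡ : ∀ k → coeff p k ≡ coeff q k
open _≈_ public

≈-setoid : Setoid 0ℓ 0ℓ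
≈-setoid = record
  { Carrier       = Poly
  ; _≈_           = _≈_
  ; isEquivalence = record
    { refl  = coeffwise λ _ → refl
    ; sym   = λ e → coeffwise λ k → sym (coeff-≡ e k)
    ; trans = λ e f → coeffwise λ k → trans (coeff-≡ e k) (coeff-≡ f k)
    }
  }

open Setoid ≈-setoid public using () renaming (refl to ≈-refl; sym to ≈-sym; trans to ≈-trans)
module ≈-Reasoning = SetoidReasoning ≈-setoid

∷-≈ : ∀ {a b p q} → a ≡ b → p ≈ q → a ∷ p ≈ b ∷ q
∷-≈ a≡b p≈q = coeffwise λ { zero → a≡b ; (suc k) → coeff-≡ p≈q k }

coeff-drop1 : ∀ p k → coeff (drop 1 p) k ≡ coeff p (suc k)
coeff-drop1 []      k = refl
coeff-drop1 (a ∷ p) k = refl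

drop1-≈ : ∀ {p q} → p ≈ q → drop 1 p ≈ drop 1 q
drop1-≈ {p} {q} e = coeffwise λ k → trans (coeff-drop1 p k) (trans (coeff-≡ e (suc k)) (sym (coeff-drop1 q k)))

coeff-+P : ∀ p q k → coeff (p +P q) k ≡ coeff p k + coeff q k
coeff-+P []      q       k       = refl
coeff-+P (a ∷ p) []      k       = sym (+-identityʳ _)
coeff-+P (a ∷ p) (b ∷ q) zero    = refl
coeff-+P (a ∷ p) (b ∷ q) (suc k) = coeff-+P p q k

+P-cong : ∀ {p p′ q q′} → p ≈ p′ → q ≈ q′ → p +P q ≈ p′ +P q′
+P-cong {p} {p′} {q} {q′} e f = coeffwise λ k →
  trans (coeff-+P p q k) (trans (cong₂ _+_ (coeff-≡ e k) (coeff-≡ f k)) (sym (coeff-+P p′ q′ k)))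

+P-assoc : ∀ p q r → (p +P q) +P r ≈ p +P (q +P r)
+P-assoc p q r = coeffwise λ k → begin
  coeff ((p +P q) +P r) k              ≡⟨ coeff-+P (p +P q) r k ⟩
  coeff (p +P q) k + coeff r k          ≡⟨ cong (_+ coeff r k) (coeff-+P p q k) ⟩
  coeff p k + coeff q k + coeff r k     ≡⟨ +-assoc (coeff p k) (coeff q k) (coeff r k) ⟩
  coeff p k + (coeff q k + coeff r k)   ≡⟨ cong (coeff p k +_) (coeff-+P q r k) ⟨
  coeff p k + coeff (q +P r) k          ≡⟨ coeff-+P p (q +P r) k ⟨
  coeff (p +P (q +P r)) k               ∎
  where open ≡-Reasoning

drop1-+P : ∀ p q → drop 1 (p +P q) ≈ drop 1 p +P drop 1 q
drop1-+P p q = coeffwise λ k →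
  trans (coeff-drop1 (p +P q) k) (trans (coeff-+P p q (suc k))
    (trans (sym (cong₂ _+_ (coeff-drop1 p k) (coeff-drop1 q k))) (sym (coeff-+P (drop 1 p) (drop 1 q) k))))

coeff-map-* : ∀ a q k → coeff (map (a *_) q) k ≡ a * coeff q k
coeff-map-* a []      k       = sym (*-zeroʳ a)
coeff-map-* a (b ∷ q) zero    = refl
coeff-map-* a (b ∷ q) (suc k) = coeff-map-* a q k

coeff-*P-zero : ∀ p q → coeff (p *P q) 0 ≡ coeff p 0 * coeff q 0
coeff-*P-zero []      q = refl
coeff-*P-zero (a ∷ p) q = trans (coeff-+P (map (a *_) q) (0 ∷ (p *P q)) 0)
                                (trans (+-identityʳ _) (coeff-map-* a q 0))

coeff-*P-suc : ∀ p q k → coeff (p *P q) (suc k) ≡ coeff p 0 * coeff q (suc k) + coeff (drop 1 p *P q) k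
coeff-*P-suc []      q k = refl
coeff-*P-suc (a ∷ p) q k = trans (coeff-+P (map (a *_) q) (0 ∷ (p *P q)) (suc k))
                                 (cong (_+ coeff (p *P q) k) (coeff-map-* a q (suc k)))

*P-congˡ : ∀ {p p′} q → p ≈ p′ → p *P q ≈ p′ *P q
*P-congˡ q e = coeffwise (go q e)
  where
    go : ∀ {p p′} q → p ≈ p′ → ∀ k → coeff (p *P q) k ≡ coeff (p′ *P q) k
    go {p} {p′} q e zero =
      trans (coeff-*P-zero p q) (trans (cong (_* coeff q 0) (coeff-≡ e 0)) (sym (coeff-*P-zero p′ q)))
    go {p} {p′} q e (suc k) =
      trans (coeff-*P-suc p q k)
        (trans (cong₂ _+_ (cong (_* coeff q (suc k)) (coeff-≡ e 0)) (go q (drop1-≈ e) k)) (sym (coeff-*P-suc p′ q k)))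

*P-congʳ : ∀ p {q q′} → q ≈ q′ → p *P q ≈ p *P q′
*P-congʳ p e = coeffwise (go p e)
  where
    go : ∀ p {q q′} → q ≈ q′ → ∀ k → coeff (p *P q) k ≡ coeff (p *P q′) k
    go p {q} {q′} e zero =
      trans (coeff-*P-zero p q) (trans (cong (coeff p 0 *_) (coeff-≡ e 0)) (sym (coeff-*P-zero p q′)))
    go p {q} {q′} e (suc k) =
      trans (coeff-*P-suc p q k)
        (trans (cong₂ _+_ (cong (coeff p 0 *_) (coeff-≡ e (suc k))) (go (drop 1 p) e k)) (sym (coeff-*P-suc p q′ k)))

*P-distribʳ : ∀ p p′ q → (p +P p′) *P q ≈ (p *P q) +P (p′ *P q)
*P-distribʳ p p′ q = coeffwise (go p p′ q)
  where
    regroup : ∀ a b c x y → (a + b) * c + (x + y) ≡ (a * c + x) + (b * c + y)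
    regroup = solve-∀

    go : ∀ p p′ q k → coeff ((p +P p′) *P q) k ≡ coeff ((p *P q) +P (p′ *P q)) k
    go p p′ q zero = begin
      coeff ((p +P p′) *P q) 0                     ≡⟨ coeff-*P-zero (p +P p′) q ⟩
      coeff (p +P p′) 0 * coeff q 0                ≡⟨ cong (_* coeff q 0) (coeff-+P p p′ 0) ⟩
      (coeff p 0 + coeff p′ 0) * coeff q 0         ≡⟨ *-distribʳ-+ (coeff q 0) (coeff p 0) (coeff p′ 0) ⟩
      coeff p 0 * coeff q 0 + coeff p′ 0 * coeff q 0
        ≡⟨ cong₂ _+_ (coeff-*P-zero p q) (coeff-*P-zero p′ q) ⟨
      coeff (p *P q) 0 + coeff (p′ *P q) 0         ≡⟨ coeff-+P (p *P q) (p′ *P q) 0 ⟨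
      coeff ((p *P q) +P (p′ *P q)) 0              ∎
      where open ≡-Reasoning
    go p p′ q (suc k) = begin
      coeff ((p +P p′) *P q) (suc k)                           ≡⟨ coeff-*P-suc (p +P p′) q k ⟩
      coeff (p +P p′) 0 * c + coeff (drop 1 (p +P p′) *P q) k  ≡⟨ cong₂ (λ x y → x * c + y) (coeff-+P p p′ 0) tails ⟩
      (coeff p 0 + coeff p′ 0) * c + (coeff (drop 1 p *P q) k + coeff (drop 1 p′ *P q) k)
        ≡⟨ regroup (coeff p 0) (coeff p′ 0) c _ _ ⟩
      (coeff p 0 * c + coeff (drop 1 p *P q) k) + (coeff p′ 0 * c + coeff (drop 1 p′ *P q) k)
        ≡⟨ cong₂ _+_ (coeff-*P-suc p q k) (coeff-*P-suc p′ q k) ⟨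
      coeff (p *P q) (suc k) + coeff (p′ *P q) (suc k)         ≡⟨ coeff-+P (p *P q) (p′ *P q) (suc k) ⟨
      coeff ((p *P q) +P (p′ *P q)) (suc k)                    ∎
      where
        open ≡-Reasoning
        c = coeff q (suc k)
        tails : coeff (drop 1 (p +P p′) *P q) k ≡ coeff (drop 1 p *P q) k + coeff (drop 1 p′ *P q) k
        tails = trans (coeff-≡ (*P-congˡ q (drop1-+P p p′)) k)
                  (trans (go (drop 1 p) (drop 1 p′) q k) (coeff-+P (drop 1 p *P q) (drop 1 p′ *P q) k))

*P-identityˡ : ∀ q → oneP *P q ≈ q
*P-identityˡ q = coeffwise λ
  { zero    → trans (coeff-*P-zero oneP q) (*-identityˡ _)
  ; (suc k) → trans (coeff-*P-suc oneP q k) (trans (+-identityʳ _) (*-identityˡ _))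
  }

*P-0∷ : ∀ p q → (0 ∷ p) *P q ≈ 0 ∷ (p *P q)
*P-0∷ p q = coeffwise λ
  { zero    → coeff-*P-zero (0 ∷ p) q
  ; (suc k) → coeff-*P-suc (0 ∷ p) q k
  }

monomial : ℕ → Poly
monomial zero    = oneP
monomial (suc n) = 0 ∷ monomial n

coeff-monomial-≡ : ∀ n → coeff (monomial n) n ≡ 1
coeff-monomial-≡ zero    = refl
coeff-monomial-≡ (suc n) = coeff-monomial-≡ n

coeff-monomial-≢ : ∀ {k n} → k ≢ n → coeff (monomial n) k ≡ 0
coeff-monomial-≢ {zero}  {zero}  k≢n = contradiction refl k≢n
coeff-monomial-≢ {zero}  {suc n} k≢n = refl
coeff-monomial-≢ {suc k} {zero}  k≢n = refl
coeff-monomial-≢ {suc k} {suc n} k≢n = coeff-monomial-≢ (k≢n ∘ cong suc)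

sum-+P : ∀ p q → sum (p +P q) ≡ sum p + sum q
sum-+P []      q       = refl
sum-+P (a ∷ p) []      = sym (+-identityʳ _)
sum-+P (a ∷ p) (b ∷ q) rewrite sum-+P p q = regroup a b (sum p) (sum q)
  where
    regroup : ∀ a b x y → a + b + (x + y) ≡ a + x + (b + y)
    regroup = solve-∀

sum-≈ : ∀ p q → p ≈ q → sum p ≡ sum q
sum-≈ []      []      e = refl
sum-≈ []      (b ∷ q) e = cong₂ _+_ (coeff-≡ e 0) (sum-≈ [] q (drop1-≈ e))
sum-≈ (a ∷ p) []      e = cong₂ _+_ (coeff-≡ e 0) (sum-≈ p [] (drop1-≈ e))
sum-≈ (a ∷ p) (b ∷ q) e = cong₂ _+_ (coeff-≡ e 0) (sum-≈ p q (drop1-≈ e))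

coeff-Δ-zero : ∀ p → coeff (Δ p) 0 ≡ sum p
coeff-Δ-zero []      = refl
coeff-Δ-zero (a ∷ p) = refl

coeff-Δ-suc : ∀ p k → coeff (Δ p) (suc k) ≡ coeff (Δ (drop 1 p)) k
coeff-Δ-suc []      k = refl
coeff-Δ-suc (a ∷ p) k = refl

coeff-Δ : ∀ p k → coeff (Δ p) k ≡ coeff p k + coeff (Δ p) (suc k)
coeff-Δ []      k       = refl
coeff-Δ (a ∷ p) zero    = cong (a +_) (sym (coeff-Δ-zero p))
coeff-Δ (a ∷ p) (suc k) = coeff-Δ p k

Δ-cong : ∀ {p q} → p ≈ q → Δ p ≈ Δ q
Δ-cong e = coeffwise (go _ _ e)
  where
    go : ∀ p q → p ≈ q → ∀ k → coeff (Δ p) k ≡ coeff (Δ q) k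
    go p q e zero    = trans (coeff-Δ-zero p) (trans (sum-≈ p q e) (sym (coeff-Δ-zero q)))
    go p q e (suc k) =
      trans (coeff-Δ-suc p k) (trans (go (drop 1 p) (drop 1 q) (drop1-≈ e) k) (sym (coeff-Δ-suc q k)))

Δ-+P : ∀ p q → Δ (p +P q) ≈ Δ p +P Δ q
Δ-+P p q = coeffwise (go p q)
  where
    regroup : ∀ a b x y → a + b + (x + y) ≡ a + x + (b + y)
    regroup = solve-∀

    go : ∀ p q k → coeff (Δ (p +P q)) k ≡ coeff (Δ p +P Δ q) k
    go []      q       k       = refl
    go (a ∷ p) []      k       = refl
    go (a ∷ p) (b ∷ q) zero    = trans (cong (a + b +_) (sum-+P p q)) (regroup a b (sum p) (sum q))
    go (a ∷ p) (b ∷ q) (suc k) = go p q k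

Δ-0∷ : ∀ q → Δ (0 ∷ q) ≈ (0 ∷ q) +P Δ q
Δ-0∷ q = coeffwise λ
  { zero    → trans (sym (coeff-Δ-zero q)) (sym (coeff-+P (0 ∷ q) (Δ q) 0))
  ; (suc k) → trans (coeff-Δ q k) (sym (coeff-+P (0 ∷ q) (Δ q) (suc k)))
  }

gf : ∀ {A : Set} → (A → ℕ) → List A → Poly
gf γ []       = []
gf γ (x ∷ xs) = monomial (γ x) +P gf γ xs

gf-++ : ∀ {A : Set} (γ : A → ℕ) xs ys → gf γ (xs ++ ys) ≈ gf γ xs +P gf γ ys
gf-++ γ []       ys = ≈-refl
gf-++ γ (x ∷ xs) ys =
  ≈-trans (+P-cong (≈-refl {monomial (γ x)}) (gf-++ γ xs ys)) (≈-sym (+P-assoc (monomial (γ x)) (gf γ xs) (gf γ ys)))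

gf-map : ∀ {A B : Set} (γ : B → ℕ) (f : A → B) xs → gf γ (map f xs) ≡ gf (γ ∘ f) xs
gf-map γ f []       = refl
gf-map γ f (x ∷ xs) = cong (monomial (γ (f x)) +P_) (gf-map γ f xs)

gf-cong : ∀ {A : Set} {γ δ : A → ℕ} → (∀ x → γ x ≡ δ x) → ∀ xs → gf γ xs ≡ gf δ xs
gf-cong e []       = refl
gf-cong e (x ∷ xs) = cong₂ (λ a p → monomial a +P p) (e x) (gf-cong e xs)

gf-suc : ∀ {A : Set} (γ : A → ℕ) xs → gf (suc ∘ γ) xs ≈ 0 ∷ gf γ xs
gf-suc γ []       = coeffwise λ { zero → refl ; (suc k) → refl }
gf-suc γ (x ∷ xs) = +P-cong (≈-refl {monomial (suc (γ x))}) (gf-suc γ xs)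

gf-shift : ∀ {A : Set} (γ : A → ℕ) j xs → gf (λ x → j + γ x) xs ≈ monomial j *P gf γ xs
gf-shift γ zero    xs = ≈-sym (*P-identityˡ (gf γ xs))
gf-shift γ (suc j) xs = begin
  gf (λ x → suc (j + γ x)) xs        ≈⟨ gf-suc (λ x → j + γ x) xs ⟩
  0 ∷ gf (λ x → j + γ x) xs          ≈⟨ ∷-≈ refl (gf-shift γ j xs) ⟩
  0 ∷ (monomial j *P gf γ xs)        ≈⟨ *P-0∷ (monomial j) (gf γ xs) ⟨
  monomial (suc j) *P gf γ xs        ∎
  where open ≈-Reasoning

length-filter-≡-coeff-gf : ∀ {A : Set} (γ : A → ℕ) xs k →
  length (filter (λ x → γ x ≟ k) xs) ≡ coeff (gf γ xs) k
length-filter-≡-coeff-gf γ []       k = refl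
length-filter-≡-coeff-gf γ (x ∷ xs) k with γ x ≟ k
... | yes γx≡k rewrite filter-accept (λ y → γ y ≟ k) {x} {xs} γx≡k | coeff-+P (monomial (γ x)) (gf γ xs) k
                     | γx≡k | coeff-monomial-≡ k = cong suc (length-filter-≡-coeff-gf γ xs k)
... | no  γx≢k rewrite filter-reject (λ y → γ y ≟ k) {x} {xs} γx≢k | coeff-+P (monomial (γ x)) (gf γ xs) k
                     | coeff-monomial-≢ (γx≢k ∘ sym) = length-filter-≡-coeff-gf γ xs k

record Linear (Φ : Poly → Poly) : Set where
  field
    Φ-cong : ∀ {p q} → p ≈ q → Φ p ≈ Φ q
    Φ-[]   : Φ [] ≈ []
    Φ-+P   : ∀ p q → Φ (p +P q) ≈ Φ p +P Φ q
open Linear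

*P-linear : ∀ q → Linear (_*P q)
*P-linear q = record { Φ-cong = *P-congˡ q ; Φ-[] = ≈-refl ; Φ-+P = λ p p′ → *P-distribʳ p p′ q }

Δ-linear : Linear Δ
Δ-linear = record { Φ-cong = Δ-cong ; Φ-[] = ≈-refl ; Φ-+P = Δ-+P }

∘-linear : ∀ {Φ Ψ} → Linear Φ → Linear Ψ → Linear (Φ ∘ Ψ)
∘-linear {Φ} {Ψ} lΦ lΨ = record
  { Φ-cong = Φ-cong lΦ ∘ Φ-cong lΨ
  ; Φ-[]   = ≈-trans (Φ-cong lΦ (Φ-[] lΨ)) (Φ-[] lΦ)
  ; Φ-+P   = λ p q → ≈-trans (Φ-cong lΦ (Φ-+P lΨ p q)) (Φ-+P lΦ (Ψ p) (Ψ q))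
  }

gf-concatMap : ∀ {A B : Set} {Φ} → Linear Φ → (γ : B → ℕ) (α : A → ℕ) (f : A → List B) →
  (∀ x → gf γ (f x) ≈ Φ (monomial (α x))) → ∀ xs → gf γ (concatMap f xs) ≈ Φ (gf α xs)
gf-concatMap lΦ γ α f gf-f []       = ≈-sym (Φ-[] lΦ)
gf-concatMap lΦ γ α f gf-f (x ∷ xs) =
  ≈-trans (gf-++ γ (f x) (concatMap f xs))
    (≈-trans (+P-cong (gf-f x) (gf-concatMap lΦ γ α f gf-f xs)) (≈-sym (Φ-+P lΦ (monomial (α x)) (gf α xs))))

Unique-concatMap : ∀ {A B : Set} (f : A → List B) {xs} → Unique xs → (∀ x → x ∈ xs → Unique (f x)) →
  (∀ {x x′ y} → x ∈ xs → x′ ∈ xs → y ∈ f x → y ∈ f x′ → x ≡ x′) → Unique (concatMap f xs)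
Unique-concatMap f {[]}     []           _      _        = []
Unique-concatMap f {x ∷ xs} (x∉xs ∷ uxs) unique disjoint =
  ++⁺ (unique x (here refl)) (Unique-concatMap f uxs (λ x′ → unique x′ ∘ there) (λ i i′ → disjoint (there i) (there i′)))
      (λ (y∈fx , y∈rest) → separate y∈fx y∈rest)
  where
    separate : ∀ {y} → y ∈ f x → y ∈ concatMap f xs → ⊥
    separate y∈fx y∈rest with find (∈-concatMap⁻ f {xs} y∈rest)
    ... | x′ , x′∈xs , y∈fx′ = All.lookup x∉xs x′∈xs (disjoint (here refl) (there x′∈xs) y∈fx y∈fx′)

splits : ∀ {A : Set} → List A → List (List A × List A)
splits []      = ([] , []) ∷ []
splits (y ∷ x) = ([] , y ∷ x) ∷ map (λ (a , b) → y ∷ a , b) (splits x)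

∈-splits⁻ : ∀ {A : Set} {a b : List A} x → (a , b) ∈ splits x → a ++ b ≡ x
∈-splits⁻ []      (here refl) = refl
∈-splits⁻ (y ∷ x) (here refl) = refl
∈-splits⁻ (y ∷ x) (there i) with ∈-map⁻ (λ (a , b) → y ∷ a , b) i
... | _ , i′ , refl = cong (y ∷_) (∈-splits⁻ x i′)

∈-splits⁺ : ∀ {A : Set} (a b : List A) → (a , b) ∈ splits (a ++ b)
∈-splits⁺ []      []      = here refl
∈-splits⁺ []      (_ ∷ _) = here refl
∈-splits⁺ (y ∷ a) b       = there (∈-map⁺ (λ (a , b) → y ∷ a , b) (∈-splits⁺ a b))

Unique-splits : ∀ {A : Set} (x : List A) → Unique (splits x)
Unique-splits []      = All.[] ∷ []
Unique-splits (y ∷ x) = All.tabulate first≢ ∷ map⁺ cons-injective (Unique-splits x)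
  where
    cons-injective : ∀ {u v : List _ × List _} → (y ∷ proj₁ u , proj₂ u) ≡ (y ∷ proj₁ v , proj₂ v) → u ≡ v
    cons-injective refl = refl
    first≢ : ∀ {z} → z ∈ map (λ (a , b) → y ∷ a , b) (splits x) → ([] , y ∷ x) ≢ z
    first≢ i refl with ∈-map⁻ (λ (a , b) → y ∷ a , b) i
    ... | _ , _ , ()

gf-splits : ∀ {A : Set} (x : List A) → gf (length ∘ proj₂) (splits x) ≈ Δ (monomial (length x))
gf-splits []      = ≈-refl
gf-splits (y ∷ x) = begin
  monomial (suc n) +P gf (length ∘ proj₂) (map (λ (a , b) → y ∷ a , b) (splits x))
    ≡⟨ cong (monomial (suc n) +P_) (gf-map (length ∘ proj₂) (λ (a , b) → y ∷ a , b) (splits x)) ⟩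
  monomial (suc n) +P gf (length ∘ proj₂) (splits x)  ≈⟨ +P-cong (≈-refl {monomial (suc n)}) (gf-splits x) ⟩
  monomial (suc n) +P Δ (monomial n)                  ≈⟨ Δ-0∷ (monomial n) ⟨
  Δ (monomial (suc n))                                ∎
  where
    open ≈-Reasoning
    n = length x

module Enumeration (m : ℕ) where

  open Encoding (suc m)
  open Rotations m

  attach : Forest → Vec Forest (suc m) × Forest → Forest
  attach G (Gs , c) = G ++ prim Gs ∷ c

  extend : ∀ {k} → Forest → Vec Forest k × Forest → List (Vec Forest (suc k) × Forest)
  extend q (Gs , c) = map (λ (a , b) → a ∷ Gs , b) (splits (c ++ q))

  mutual
    downset : Tree (suc m) → List Forest
    downset leaf        = [] ∷ []
    downset (node l rs) = concatMap (attachAll rs) (downset l)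

    attachAll : Vec (Tree (suc m)) (suc m) → Forest → List Forest
    attachAll rs G = map (attach G) (downsetKids rs)

    downsetKids : ∀ {k} → Vec (Tree (suc m)) k → List (Vec Forest k × Forest)
    downsetKids []       = ([] , []) ∷ []
    downsetKids (r ∷ rs) = concatMap (extendAll rs) (downset r)

    extendAll : ∀ {k} → Vec (Tree (suc m)) k → Forest → List (Vec Forest (suc k) × Forest)
    extendAll rs q = concatMap (extend q) (downsetKids rs)

  ∈-extend⁻ : ∀ {k} q (z : Vec Forest k × Forest) {y} → y ∈ extend q z →
    ∃₂ λ a b → y ≡ (a ∷ proj₁ z , b) × a ++ b ≡ proj₂ z ++ q
  ∈-extend⁻ q (Gs , c) i with ∈-map⁻ (λ (a , b) → a ∷ Gs , b) i
  ... | (a , b) , ab∈ , refl = a , b , refl , ∈-splits⁻ (c ++ q) ab∈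

  Below-++ : ∀ {G₁ A G₂ B} → Below G₁ A → Below G₂ B → Below (G₁ ++ G₂) (A ++ B)
  Below-++ [] b₂ = b₂
  Below-++ {G₂ = G₂} (_∷_ {Gs} {c} {r = r} bk b) b₂ =
    subst (λ z → Below (prim Gs ∷ z) _) (sym (++-assoc c r G₂)) (bk ∷ Below-++ b b₂)

  Below-++⁻ : ∀ A {B G} → Below G (A ++ B) → ∃₂ λ G₁ G₂ → G ≡ G₁ ++ G₂ × Below G₁ A × Below G₂ B
  Below-++⁻ []      b = [] , _ , refl , [] , b
  Below-++⁻ (_ ∷ A) (_∷_ {Gs} {c} bk b) with Below-++⁻ A b
  ... | G₁ , G₂ , refl , b₁ , b₂ = prim Gs ∷ (c ++ G₁) , G₂ , cong (prim Gs ∷_) (sym (++-assoc c G₁ G₂)) , bk ∷ b₁ , b₂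

  Below-[prim]⁺ : ∀ {Gs c ks} → BelowKids Gs c ks → Below (prim Gs ∷ c) [ prim ks ]
  Below-[prim]⁺ {Gs} {c} bk = subst (λ z → Below (prim Gs ∷ z) _) (++-identityʳ c) (bk ∷ [])

  Below-[prim]⁻ : ∀ {G ks} → Below G [ prim ks ] → ∃₂ λ Gs c → G ≡ prim Gs ∷ c × BelowKids Gs c ks
  Below-[prim]⁻ (_∷_ {Gs} {c} bk []) = Gs , c , cong (prim Gs ∷_) (++-identityʳ c) , bk

  mutual
    downset-sound : ∀ T {G} → G ∈ downset T → Below G (toForest T)
    downset-sound leaf        (here refl) = []
    downset-sound (node l rs) i with find (∈-concatMap⁻ (attachAll rs) {downset l} i)
    ... | G , G∈ , j with ∈-map⁻ (attach G) j
    ...   | (Gs , c) , z∈ , refl = Below-++ (downset-sound l G∈) (Below-[prim]⁺ (downsetKids-sound rs z∈))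

    downsetKids-sound : ∀ {k} (rs : Vec (Tree (suc m)) k) {Gs c} → (Gs , c) ∈ downsetKids rs → BelowKids Gs c (toKids rs)
    downsetKids-sound []       (here refl) = []
    downsetKids-sound (r ∷ rs) i with find (∈-concatMap⁻ (extendAll rs) {downset r} i)
    ... | q , q∈ , j with find (∈-concatMap⁻ (extend q) {downsetKids rs} j)
    ...   | z , z∈ , y∈ with ∈-extend⁻ q z y∈
    ...     | a , b , refl , eq = cut (downsetKids-sound rs z∈) (downset-sound r q∈) eq

  mutual
    downset-complete : ∀ T {G} → Below G (toForest T) → G ∈ downset T
    downset-complete leaf        []    = here refl
    downset-complete (node l rs) below with Below-++⁻ (toForest l) below
    ... | G₁ , G₂ , refl , b₁ , b₂ with Below-[prim]⁻ b₂
    ...   | Gs , c , refl , bk = ∈-concatMap⁺ (attachAll rs) {downset l}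
                                   (lose (downset-complete l b₁) (∈-map⁺ (attach G₁) (downsetKids-complete rs bk)))

    downsetKids-complete : ∀ {k} (rs : Vec (Tree (suc m)) k) {Gs c} → BelowKids Gs c (toKids rs) → (Gs , c) ∈ downsetKids rs
    downsetKids-complete []       []                                      = here refl
    downsetKids-complete (r ∷ rs) (cut {Gs = Gs} {c = c} {q} {a = a} {b} bk bq eq) =
      ∈-concatMap⁺ (extendAll rs) {downset r} (lose (downset-complete r bq)
        (∈-concatMap⁺ (extend q) {downsetKids rs} (lose (downsetKids-complete rs bk)
          (∈-map⁺ (λ (a , b) → a ∷ Gs , b) (subst (λ w → (a , b) ∈ splits w) eq (∈-splits⁺ a b))))))

  mutual
    Below-size : ∀ {G F} → Below G F → forestSize G ≡ forestSize F
    Below-size [] = refl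
    Below-size (_∷_ {Gs} {c} {ks} {r} {ps} bk b) = cong suc (begin
      kidsSize Gs + forestSize (c ++ r)              ≡⟨ cong (kidsSize Gs +_) (forestSize-++ c r) ⟩
      kidsSize Gs + (forestSize c + forestSize r)    ≡⟨ +-assoc (kidsSize Gs) _ _ ⟨
      kidsSize Gs + forestSize c + forestSize r      ≡⟨ cong₂ _+_ (BelowKids-size bk) (Below-size b) ⟩
      kidsSize ks + forestSize ps                    ∎)
      where open ≡-Reasoning

    BelowKids-size : ∀ {k} {Gs Fs : Vec Forest k} {c} → BelowKids Gs c Fs → kidsSize Gs + forestSize c ≡ kidsSize Fs
    BelowKids-size [] = refl
    BelowKids-size (cut {Gs = Gs} {Fs} {c} {q} {F} {a} {b} bk bq eq) = begin
      forestSize a + kidsSize Gs + forestSize b      ≡⟨ regroup (forestSize a) (kidsSize Gs) (forestSize b) ⟩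
      kidsSize Gs + (forestSize a + forestSize b)    ≡⟨ cong (kidsSize Gs +_) (forestSize-++ a b) ⟨
      kidsSize Gs + forestSize (a ++ b)              ≡⟨ cong (λ w → kidsSize Gs + forestSize w) eq ⟩
      kidsSize Gs + forestSize (c ++ q)              ≡⟨ cong (kidsSize Gs +_) (forestSize-++ c q) ⟩
      kidsSize Gs + (forestSize c + forestSize q)    ≡⟨ +-assoc (kidsSize Gs) _ _ ⟨
      kidsSize Gs + forestSize c + forestSize q      ≡⟨ cong₂ _+_ (BelowKids-size bk) (Below-size bq) ⟩
      kidsSize Fs + forestSize F                     ≡⟨ +-comm (kidsSize Fs) _ ⟩
      forestSize F + kidsSize Fs                     ∎
      where
        open ≡-Reasoning
        regroup : ∀ a g b → a + g + b ≡ g + (a + b)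
        regroup = solve-∀

  downset-size : ∀ T {G} → G ∈ downset T → forestSize G ≡ forestSize (toForest T)
  downset-size T = Below-size ∘ downset-sound T

  ++-cancel-by-size : ∀ A A′ {X X′} → forestSize A ≡ forestSize A′ → A ++ X ≡ A′ ++ X′ → A ≡ A′ × X ≡ X′
  ++-cancel-by-size A A′ {X} {X′} same eq with levi A X A′ X′ eq
  ... | inj₁ ([] , p , q)       = sym (trans p (++-identityʳ A)) , q
  ... | inj₂ ([] , p , q)       = trans p (++-identityʳ A′) , sym q
  ... | inj₁ (prim _ ∷ e , refl , _) =
    ⊥-elim (m≢1+m+n (forestSize A) (trans same (trans (forestSize-++ A (prim _ ∷ e)) (+-suc _ _))))
  ... | inj₂ (prim _ ∷ e , refl , _) =
    ⊥-elim (m≢1+m+n (forestSize A′) (trans (sym same) (trans (forestSize-++ A′ (prim _ ∷ e)) (+-suc _ _))))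

  downsetKids-size : ∀ {k} (rs : Vec (Tree (suc m)) k) {Gs c} → (Gs , c) ∈ downsetKids rs →
    kidsSize Gs + forestSize c ≡ kidsSize (toKids rs)
  downsetKids-size rs = BelowKids-size ∘ downsetKids-sound rs

  attach-injective : ∀ G {z z′} → attach G z ≡ attach G z′ → z ≡ z′
  attach-injective G e with ++-cancelˡ G _ _ e
  ... | refl = refl

  mutual
    downset-unique : ∀ T → Unique (downset T)
    downset-unique leaf        = All.[] ∷ []
    downset-unique (node l rs) =
      Unique-concatMap (attachAll rs) (downset-unique l) (λ G _ → map⁺ (attach-injective G) (downsetKids-unique rs)) same-G
      where
        same-G : ∀ {G G′ y} → G ∈ downset l → G′ ∈ downset l → y ∈ attachAll rs G → y ∈ attachAll rs G′ → G ≡ G′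
        same-G {G} {G′} G∈ G′∈ i i′ with ∈-map⁻ (attach G) i | ∈-map⁻ (attach G′) i′
        ... | _ , _ , refl | _ , _ , e =
          proj₁ (++-cancel-by-size G G′ (trans (downset-size l G∈) (sym (downset-size l G′∈))) e)

    downsetKids-unique : ∀ {k} (rs : Vec (Tree (suc m)) k) → Unique (downsetKids rs)
    downsetKids-unique []       = All.[] ∷ []
    downsetKids-unique (r ∷ rs) = Unique-concatMap (extendAll rs) (downset-unique r) (λ q _ → extendAll-unique q) same-q
      where
        cut-injective : ∀ {Gs} {u v : Forest × Forest} →
          _≡_ {A = Vec Forest _ × Forest} (proj₁ u ∷ Gs , proj₂ u) (proj₁ v ∷ Gs , proj₂ v) → u ≡ v
        cut-injective refl = refl

        same-z : ∀ q {z z′ y} → z ∈ downsetKids rs → z′ ∈ downsetKids rs → y ∈ extend q z → y ∈ extend q z′ → z ≡ z′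
        same-z q {z} {z′} _ _ i i′ with ∈-extend⁻ q z i | ∈-extend⁻ q z′ i′
        ... | a , b , refl , eq | _ , _ , refl , eq′ with ++-cancelʳ q (proj₂ z) (proj₂ z′) (trans (sym eq) eq′)
        ...   | refl = refl

        extendAll-unique : ∀ q → Unique (extendAll rs q)
        extendAll-unique q = Unique-concatMap (extend q) (downsetKids-unique rs)
          (λ z _ → map⁺ cut-injective (Unique-splits (proj₂ z ++ q))) (same-z q)

        same-q : ∀ {q q′ y} → q ∈ downset r → q′ ∈ downset r → y ∈ extendAll rs q → y ∈ extendAll rs q′ → q ≡ q′
        same-q {q} {q′} _ _ i i′
          with find (∈-concatMap⁻ (extend q) {downsetKids rs} i) | find (∈-concatMap⁻ (extend q′) {downsetKids rs} i′)
        ... | z , z∈ , j | z′ , z′∈ , j′ with ∈-extend⁻ q z j | ∈-extend⁻ q′ z′ j′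
        ...   | a , b , refl , eq | _ , _ , refl , eq′ =
          proj₂ (++-cancel-by-size (proj₂ z) (proj₂ z′)
                   (+-cancelˡ-≡ (kidsSize (proj₁ z)) _ _ (trans (downsetKids-size rs z∈) (sym (downsetKids-size rs z′∈))))
                   (trans (sym eq) eq′))

  mutual
    gf-downset : ∀ T → gf length (downset T) ≈ B T
    gf-downset leaf        = ≈-refl
    gf-downset (node l rs) = begin
      gf length (concatMap (attachAll rs) (downset l))
        ≈⟨ gf-concatMap (*P-linear N) length (suc ∘ length) (attachAll rs) gf-attachAll (downset l) ⟩
      gf (suc ∘ length) (downset l) *P N                ≈⟨ *P-congˡ N (gf-shift length 1 (downset l)) ⟩
      (xP *P gf length (downset l)) *P N                ≈⟨ *P-congˡ N (*P-congʳ xP (gf-downset l)) ⟩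
      (xP *P B l) *P N                                  ≈⟨ *P-congʳ (xP *P B l) (gf-downsetKids rs) ⟩
      (xP *P B l) *P nest rs                            ∎
      where
        open ≈-Reasoning
        N = gf (length ∘ proj₂) (downsetKids rs)
        gf-attachAll : ∀ G → gf length (attachAll rs G) ≈ monomial (suc (length G)) *P N
        gf-attachAll G = begin
          gf length (map (attach G) (downsetKids rs))             ≡⟨ gf-map length (attach G) (downsetKids rs) ⟩
          gf (length ∘ attach G) (downsetKids rs)
            ≡⟨ gf-cong (λ (Gs , c) → trans (length-++ G) (+-suc _ _)) (downsetKids rs) ⟩
          gf (λ z → suc (length G) + length (proj₂ z)) (downsetKids rs)
            ≈⟨ gf-shift (length ∘ proj₂) (suc (length G)) (downsetKids rs) ⟩
          monomial (suc (length G)) *P N                          ∎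

    gf-downsetKids : ∀ {k} (rs : Vec (Tree (suc m)) k) → gf (length ∘ proj₂) (downsetKids rs) ≈ nest rs
    gf-downsetKids []       = ≈-refl
    gf-downsetKids (r ∷ rs) = begin
      gf (length ∘ proj₂) (concatMap (extendAll rs) (downset r))
        ≈⟨ gf-concatMap (∘-linear Δ-linear (*P-linear N)) (length ∘ proj₂) length (extendAll rs) gf-extendAll (downset r) ⟩
      Δ (gf length (downset r) *P N)    ≈⟨ Δ-cong (*P-congˡ N (gf-downset r)) ⟩
      Δ (B r *P N)                      ≈⟨ Δ-cong (*P-congʳ (B r) (gf-downsetKids rs)) ⟩
      Δ (B r *P nest rs)                ∎
      where
        open ≈-Reasoning
        N = gf (length ∘ proj₂) (downsetKids rs)
        gf-extend : ∀ q z → gf (length ∘ proj₂) (extend q z) ≈ Δ (monomial (length q + length (proj₂ z)))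
        gf-extend q (Gs , c) = begin
          gf (length ∘ proj₂) (map (λ (a , b) → a ∷ Gs , b) (splits (c ++ q)))
            ≡⟨ gf-map (length ∘ proj₂) (λ (a , b) → a ∷ Gs , b) (splits (c ++ q)) ⟩
          gf (length ∘ proj₂) (splits (c ++ q))     ≈⟨ gf-splits (c ++ q) ⟩
          Δ (monomial (length (c ++ q)))            ≡⟨ cong (Δ ∘ monomial) (trans (length-++ c) (+-comm (length c) _)) ⟩
          Δ (monomial (length q + length c))        ∎
        gf-extendAll : ∀ q → gf (length ∘ proj₂) (extendAll rs q) ≈ Δ (monomial (length q) *P N)
        gf-extendAll q = begin
          gf (length ∘ proj₂) (concatMap (extend q) (downsetKids rs))
            ≈⟨ gf-concatMap Δ-linear (length ∘ proj₂) (λ z → length q + length (proj₂ z)) (extend q) (gf-extend q)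
                            (downsetKids rs) ⟩
          Δ (gf (λ z → length q + length (proj₂ z)) (downsetKids rs))
            ≈⟨ Δ-cong (gf-shift (length ∘ proj₂) (length q) (downsetKids rs)) ⟩
          Δ (monomial (length q) *P N)                                 ∎

  ≤T⇔Below : ∀ T′ T → T′ ≤T T ⇔ Below (toForest T′) (toForest T)
  ≤T⇔Below T′ T = mk⇔
    (Star⇒Below (toForest T′) (path-toForest T′) (path-toForest T))
    (subst₂ (Star (Rot (suc m))) (sym (path-toForest T′)) (sym (path-toForest T))
      ∘ gmap forestPath RotF⇒Rot ∘ Below⇒Star)

  ≤T⇒size≡ : ∀ {T′ T} → T′ ≤T T → size T′ ≡ size T
  ≤T⇒size≡ {T′} {T} T′≤T = begin
    size T′                   ≡⟨ size-toForest T′ ⟩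
    forestSize (toForest T′)  ≡⟨ Below-size (Equivalence.to (≤T⇔Below T′ T) T′≤T) ⟩
    forestSize (toForest T)   ≡⟨ size-toForest T ⟨
    size T                    ∎
    where open ≡-Reasoning

  ∈-downsetTrees⇔≤T : ∀ T′ T → T′ ∈ map fromForest (downset T) ⇔ T′ ≤T T
  ∈-downsetTrees⇔≤T T′ T = mk⇔ sound complete
    where
      sound : T′ ∈ map fromForest (downset T) → T′ ≤T T
      sound i with ∈-map⁻ fromForest i
      ... | G , G∈ , refl = Equivalence.from (≤T⇔Below (fromForest G) T)
                              (subst (λ H → Below H (toForest T)) (sym (toForest-fromForest G)) (downset-sound T G∈))

      complete : T′ ≤T T → T′ ∈ map fromForest (downset T)
      complete T′≤T = subst (_∈ map fromForest (downset T)) (fromForest-toForest T′)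
        (∈-map⁺ fromForest (downset-complete T (Equivalence.to (≤T⇔Below T′ T) T′≤T)))

  leftBranch-fromForest : ∀ G → leftBranch (fromForest G) ≡ length G
  leftBranch-fromForest G = trans (leftBranch-toForest (fromForest G)) (cong length (toForest-fromForest G))

  listing : ∀ T k → ∃ λ (L : List (Tree (suc m))) →
    Unique L
    × (∀ T′ → (T′ ∈ L) ⇔ ((size T′ ≡ size T) × (T′ ≤T T) × (leftBranch T′ ≡ k)))
    × (length L ≡ coeff (B T) k)
  listing T k = filter hasLeftBranch? trees , unique , members , count
    where
      hasLeftBranch? = λ (T′ : Tree (suc m)) → leftBranch T′ ≟ k
      trees = map fromForest (downset T)

      unique : Unique (filter hasLeftBranch? trees)
      unique = filter⁺ hasLeftBranch? (map⁺ fromForest-injective (downset-unique T))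

      members : ∀ T′ → (T′ ∈ filter hasLeftBranch? trees) ⇔ ((size T′ ≡ size T) × (T′ ≤T T) × (leftBranch T′ ≡ k))
      members T′ = mk⇔
        (λ i → let T′∈ , leftBranch≡k = ∈-filter⁻ hasLeftBranch? i
                   T′≤T = Equivalence.to (∈-downsetTrees⇔≤T T′ T) T′∈
               in ≤T⇒size≡ T′≤T , T′≤T , leftBranch≡k)
        (λ (_ , T′≤T , leftBranch≡k) →
          ∈-filter⁺ hasLeftBranch? (Equivalence.from (∈-downsetTrees⇔≤T T′ T) T′≤T) leftBranch≡k)

      count : length (filter hasLeftBranch? trees) ≡ coeff (B T) k
      count = begin
        length (filter hasLeftBranch? trees)
          ≡⟨ length-filter-≡-coeff-gf leftBranch trees k ⟩
        coeff (gf leftBranch trees) k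
          ≡⟨ cong (λ p → coeff p k) (gf-map leftBranch fromForest (downset T)) ⟩
        coeff (gf (leftBranch ∘ fromForest) (downset T)) k
          ≡⟨ cong (λ p → coeff p k) (gf-cong leftBranch-fromForest (downset T)) ⟩
        coeff (gf length (downset T)) k
          ≡⟨ coeff-≡ (gf-downset T) k ⟩
        coeff (B T) k
          ∎
        where open ≡-Reasoning

theorem8p2p2 : (m : ℕ) → 1 ≤ m → (n : ℕ) → (T : Tree m) → size T ≡ n →
    (k : ℕ) → ∃ λ (L : List (Tree m)) →
      Unique L
      × (∀ T' → (T' ∈ L) ⇔ ((size T' ≡ n) × (T' ≤T T) × (leftBranch T' ≡ k)))
      × (length L ≡ coeff (B T) k)
theorem8p2p2 (suc m) _ _ T refl = Enumeration.listing m T
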